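{- Let $r \geq 3$ and $n \geq (r-1)2^{r-1} + 4$, and let $G$ be a graph on $n$ vertices with $\delta(G) \geq \lfloor n/2 \rfloor + (r-3)$. Then $G$ contains a (not necessarily induced) subgraph isomorphic to the complete bipartite graph $K_{r, r-1}$.
   Context: Graphs are finite and simple; $\delta(G)$ is the minimum degree. -}

module Defs where

open import Data.Nat using (ℕ; suc; _+_; _≤_)
open import Data.Fin using (Fin)
open import Data.List using (List; length; filter)
open import Data.List using () renaming (allFin to allFinL)
open import Data.Product using (_×_; ∃; ∃-syntax; _,_)
open import Relation.Nullary using (¬_; Dec)
open import Relation.Binary.PropositionalEquality using (_≡_)
open import Function.Definitions using (Injective)
open import Level using (0ℓ)

record Graph (n : ℕ) : Set₁ where
  field
    Adj    : Fin n → Fin n → Set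
    adj?   : (u v : Fin n) → Dec (Adj u v)
    sym    : ∀ {u v} → Adj u v → Adj v u
    irrefl : ∀ {u} → ¬ Adj u u

open Graph public

degree : ∀ {n} (G : Graph n) → Fin n → ℕ
degree {n} G v = length (filter (adj? G v) (allFinL n))

MinDegreeAtLeast : ∀ {n} → Graph n → ℕ → Set
MinDegreeAtLeast {n} G d = (v : Fin n) → d ≤ degree G v

ContainsKab : ∀ {n} → Graph n → ℕ → ℕ → Set
ContainsKab {n} G a b =
  ∃ λ (f : Fin a → Fin n) → ∃ λ (g : Fin b → Fin n) →
    (Injective _≡_ _≡_ f × Injective _≡_ _≡_ g
     × ((i : Fin a) (j : Fin b) → ¬ (f i ≡ g j))
     × ((i : Fin a) (j : Fin b) → Adj G (f i) (g j)))

-- Choose k = r − 1 vertices greedily, each time a vertex u outside the current set S maximising the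
-- common neighbourhood C(S ∪ {u}). Every vertex of C(S) has at least d − |S| neighbours outside S, so
-- double counting gives |C(S ∪ {u})| (n − |S|) ≥ |C(S)| (d − |S|), and after k steps
-- n · (d)ₖ ≤ |C(S)| · (n)ₖ with falling factorials (d)ₖ = d P′ k. If n + k ≤ 2d + 1 then each factor
-- satisfies n − t ≤ 2 (d − t), whence |C(S)| ≥ n / 2ᵏ > k; so r vertices of C(S) together with S span a
-- K_{r,r−1}. This settles r ≥ 5; for r = 3, 4, where n + k ≤ 2d + 1 may fail, the greedy bound is
-- estimated directly, which is where n ≥ 12 and n ≥ 28 are used.

module Submission where

open import Defs
open import Data.Nat
  using (ℕ; zero; suc; _+_; _*_; _∸_; _^_; _/_; _%_; _≤_; _<_; s≤s; z≤n; _≤?_; >-nonZero)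
open import Data.Nat.Properties
open import Data.Nat.DivMod using (m≡m%n+[m/n]*n; m%n<n; /-mono-≤)
open import Data.Nat.Combinatorics.Base using (_P′_)
open import Data.Nat.Tactic.RingSolver using (solve-∀)
open import Algebra.Properties.CommutativeSemigroup +-commutativeSemigroup using (interchange)
open import Algebra.Properties.CommutativeSemigroup *-commutativeSemigroup
  using (x∙yz≈y∙xz; x∙yz≈yx∙z; xy∙z≈x∙zy) renaming (interchange to *-interchange)
open import Data.Bool using (true; false)
open import Data.Empty using (⊥-elim)
open import Data.Fin as F using (Fin)
open import Data.Fin.Properties using (inject≤-injective)
open import Data.List using (List; []; _∷_; length; filter; lookup; allFin)
open import Data.List.Properties using (length-tabulate)
open import Data.List.Relation.Unary.All as All using (All)
open import Data.List.Relation.Unary.All.Properties using (¬Any⇒All¬)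
open import Data.List.Relation.Unary.Any using (here; there)
open import Data.List.Relation.Unary.AllPairs using ([]; _∷_)
open import Data.List.Membership.Propositional using (_∈_; _∉_)
open import Data.List.Membership.Propositional.Properties
  using (∈-filter⁻; ∈-filter⁺; ∈-lookup; ∈-allFin)
open import Data.List.Membership.Propositional.Properties.WithK using (unique∧set⇒bag)
open import Data.List.Relation.Binary.BagAndSetEquality using (∼bag⇒↭)
open import Data.List.Relation.Binary.Permutation.Propositional.Properties using (↭-length)
open import Data.List.Relation.Unary.Unique.Propositional using (Unique)
open import Data.List.Relation.Unary.Unique.Propositional.Properties using (allFin⁺; filter⁺)
open import Data.Product using (∃; _×_; _,_; proj₂)
open import Function.Bundles using (mk⇔)
open import Level using (0ℓ)
open import Relation.Nullary using (¬_; Dec; yes; no; _because_)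
open import Relation.Unary using (Pred; Decidable)
open import Relation.Unary.Properties using (∁?)
open import Relation.Binary.PropositionalEquality
  using (_≡_; refl; cong; cong₂; subst; module ≡-Reasoning) renaming (sym to ≡-sym; trans to ≡-trans)

private
  variable
    A B : Set

∑ : List A → (A → ℕ) → ℕ
∑ []       f = 0
∑ (x ∷ xs) f = f x + ∑ xs f

syntax ∑ xs (λ x → e) = ∑[ x ← xs ] e

∑-cong : ∀ (xs : List A) {f g : A → ℕ} → (∀ x → f x ≡ g x) → ∑ xs f ≡ ∑ xs g
∑-cong []       f≡g = refl
∑-cong (x ∷ xs) f≡g = cong₂ _+_ (f≡g x) (∑-cong xs f≡g)

∑-mono-≤ : ∀ (xs : List A) {f g : A → ℕ} → (∀ x → f x ≤ g x) → ∑ xs f ≤ ∑ xs g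
∑-mono-≤ []       f≤g = z≤n
∑-mono-≤ (x ∷ xs) f≤g = +-mono-≤ (f≤g x) (∑-mono-≤ xs f≤g)

∑-const : ∀ (xs : List A) c → ∑[ _ ← xs ] c ≡ length xs * c
∑-const []       c = refl
∑-const (x ∷ xs) c = cong (c +_) (∑-const xs c)

∑-distrib-+ : ∀ (xs : List A) (f g : A → ℕ) → ∑[ x ← xs ] (f x + g x) ≡ ∑ xs f + ∑ xs g
∑-distrib-+ []       f g = refl
∑-distrib-+ (x ∷ xs) f g =
  ≡-trans (cong (f x + g x +_) (∑-distrib-+ xs f g)) (interchange (f x) (g x) (∑ xs f) (∑ xs g))

∑-comm : ∀ (xs : List A) (ys : List B) (M : A → B → ℕ) →
         ∑[ x ← xs ] ∑ ys (M x) ≡ ∑[ y ← ys ] ∑[ x ← xs ] M x y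
∑-comm xs []       M = ≡-trans (∑-const xs 0) (*-zeroʳ (length xs))
∑-comm xs (y ∷ ys) M = ≡-trans (∑-distrib-+ xs (λ x → M x y) (λ x → ∑ ys (M x)))
                               (cong (∑[ x ← xs ] M x y +_) (∑-comm xs ys M))

∃-∑≤length* : ∀ (xs : List A) (f : A → ℕ) → 0 < length xs →
              ∃ λ x → x ∈ xs × ∑ xs f ≤ length xs * f x
∃-∑≤length* (x ∷ [])     f _ = x , here refl , ≤-refl
∃-∑≤length* (x ∷ y ∷ ys) f _ with ∃-∑≤length* (y ∷ ys) f (s≤s z≤n)
... | u , u∈ , ∑≤ with f x ≤? f u
...   | yes fx≤fu = u , there u∈ , +-mono-≤ fx≤fu ∑≤
...   | no  fx≰fu = x , here refl ,
          +-monoʳ-≤ (f x) (≤-trans ∑≤ (*-monoʳ-≤ (length (y ∷ ys)) (<⇒≤ (≰⇒> fx≰fu))))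

𝟙 : {P : Set} → Dec P → ℕ
𝟙 (true  because _) = 1
𝟙 (false because _) = 0

module _ {P : Pred A 0ℓ} (P? : Decidable P) where

  length-filter≡∑𝟙 : ∀ xs → length (filter P? xs) ≡ ∑[ x ← xs ] 𝟙 (P? x)
  length-filter≡∑𝟙 []       = refl
  length-filter≡∑𝟙 (x ∷ xs) with P? x
  ... | yes _ = cong suc (length-filter≡∑𝟙 xs)
  ... | no  _ = length-filter≡∑𝟙 xs

  length-filter+∁ : ∀ xs → length (filter P? xs) + length (filter (∁? P?) xs) ≡ length xs
  length-filter+∁ []       = refl
  length-filter+∁ (x ∷ xs) with P? x
  ... | yes _ = cong suc (length-filter+∁ xs)
  ... | no  _ = ≡-trans (+-suc _ _) (cong suc (length-filter+∁ xs))

  length-filter-≤-split : ∀ {Q : Pred A 0ℓ} (Q? : Decidable Q) xs →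
    length (filter P? xs) ≤ length (filter Q? xs) + length (filter P? (filter (∁? Q?) xs))
  length-filter-≤-split Q? []       = z≤n
  length-filter-≤-split Q? (x ∷ xs) with Q? x
  ... | yes _ with P? x
  ...   | yes _ = s≤s (length-filter-≤-split Q? xs)
  ...   | no  _ = m≤n⇒m≤1+n (length-filter-≤-split Q? xs)
  length-filter-≤-split Q? (x ∷ xs) | no _ with P? x
  ...   | yes _ = ≤-trans (s≤s (length-filter-≤-split Q? xs)) (≤-reflexive (≡-sym (+-suc _ _)))
  ...   | no  _ = length-filter-≤-split Q? xs

double-count : ∀ {R : A → B → Set} (R? : ∀ x y → Dec (R x y)) (xs : List A) (ys : List B) →
  ∑[ x ← xs ] length (filter (R? x) ys) ≡ ∑[ y ← ys ] length (filter (λ x → R? x y) xs)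
double-count R? xs ys = begin
  ∑[ x ← xs ] length (filter (R? x) ys)
    ≡⟨ ∑-cong xs (λ x → length-filter≡∑𝟙 (R? x) ys) ⟩
  ∑[ x ← xs ] ∑[ y ← ys ] 𝟙 (R? x y)
    ≡⟨ ∑-comm xs ys (λ x y → 𝟙 (R? x y)) ⟩
  ∑[ y ← ys ] ∑[ x ← xs ] 𝟙 (R? x y)
    ≡⟨ ∑-cong ys (λ y → length-filter≡∑𝟙 (λ x → R? x y) xs) ⟨
  ∑[ y ← ys ] length (filter (λ x → R? x y) xs)  ∎
  where open ≡-Reasoning

lookup-injective : ∀ {xs : List A} → Unique xs → ∀ i j → lookup xs i ≡ lookup xs j → i ≡ j
lookup-injective (x∉ ∷ xs!) F.zero    F.zero    _  = refl
lookup-injective (x∉ ∷ xs!) F.zero    (F.suc j) eq = ⊥-elim (All.lookup x∉ (∈-lookup j) eq)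
lookup-injective (x∉ ∷ xs!) (F.suc i) F.zero    eq = ⊥-elim (All.lookup x∉ (∈-lookup i) (≡-sym eq))
lookup-injective (x∉ ∷ xs!) (F.suc i) (F.suc j) eq = cong F.suc (lookup-injective xs! i j eq)

P′-positive : ∀ {b} k → k ≤ b → 0 < b P′ k
P′-positive zero    _   = s≤s z≤n
P′-positive (suc k) k<b = *-mono-≤ (m<n⇒0<n∸m k<b) (P′-positive k (<⇒≤ k<b))

∸≤2*∸ : ∀ {a b} t → t + a ≤ 2 * b → a ∸ t ≤ 2 * (b ∸ t)
∸≤2*∸ {a} {b} t t+a≤2b = begin
  a ∸ t               ≡⟨ [m+n]∸[m+o]≡n∸o t a t ⟨
  (t + a) ∸ (t + t)   ≤⟨ ∸-monoˡ-≤ (t + t) t+a≤2b ⟩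
  2 * b ∸ (t + t)     ≡⟨ cong (λ u → 2 * b ∸ (t + u)) (+-identityʳ t) ⟨
  2 * b ∸ 2 * t       ≡⟨ *-distribˡ-∸ 2 b t ⟨
  2 * (b ∸ t)         ∎
  where open ≤-Reasoning

P′≤2^*P′ : ∀ a b k → k + a ≤ suc (2 * b) → a P′ k ≤ 2 ^ k * (b P′ k)
P′≤2^*P′ a b zero    _             = ≤-refl
P′≤2^*P′ a b (suc k) (s≤s k+a≤2b) = begin
  (a ∸ k) * (a P′ k)
    ≤⟨ *-mono-≤ (∸≤2*∸ k k+a≤2b) (P′≤2^*P′ a b k (m≤n⇒m≤1+n k+a≤2b)) ⟩
  (2 * (b ∸ k)) * (2 ^ k * (b P′ k))
    ≡⟨ *-interchange 2 (b ∸ k) (2 ^ k) (b P′ k) ⟩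
  (2 * 2 ^ k) * ((b ∸ k) * (b P′ k))  ∎
  where open ≤-Reasoning

module _ {n : ℕ} where

  open import Data.List.Membership.DecPropositional (F._≟_ {n}) using (_∈?_)

  length-filter-∈ : ∀ (S : List (Fin n)) → Unique S →
                    length (filter (_∈? S) (allFin n)) ≡ length S
  length-filter-∈ S S! =
    ↭-length (∼bag⇒↭ (unique∧set⇒bag (filter⁺ (_∈? S) (allFin⁺ n)) S! (mk⇔ ∈S⇒ (∈-filter⁺ (_∈? S) (∈-allFin _)))))
    where
      ∈S⇒ : ∀ {x} → x ∈ filter (_∈? S) (allFin n) → x ∈ S
      ∈S⇒ x∈ = proj₂ (∈-filter⁻ (_∈? S) {xs = allFin n} x∈)

  outside : List (Fin n) → List (Fin n)
  outside S = filter (∁? (_∈? S)) (allFin n)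

  outside-∉ : ∀ S {u} → u ∈ outside S → u ∉ S
  outside-∉ S u∈ = proj₂ (∈-filter⁻ (∁? (_∈? S)) {xs = allFin n} u∈)

  length-outside : ∀ S → Unique S → length (outside S) ≡ n ∸ length S
  length-outside S S! = begin
    length (outside S)                            ≡⟨ m+n∸m≡n (length inS) _ ⟨
    length inS + length (outside S) ∸ length inS  ≡⟨ cong₂ _∸_ (length-filter+∁ (_∈? S) (allFin n))
                                                                (length-filter-∈ S S!) ⟩
    length (allFin n) ∸ length S                  ≡⟨ cong (_∸ length S) (length-tabulate _) ⟩
    n ∸ length S                                  ∎
    where
      inS = filter (_∈? S) (allFin n)
      open ≡-Reasoning

  module _ (G : Graph n) where

    commonNbrs : List (Fin n) → List (Fin n)
    commonNbrs []      = allFin n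
    commonNbrs (u ∷ S) = filter (λ w → adj? G w u) (commonNbrs S)

    commonNbrs-Unique : ∀ S → Unique (commonNbrs S)
    commonNbrs-Unique []      = allFin⁺ n
    commonNbrs-Unique (u ∷ S) = filter⁺ (λ w → adj? G w u) (commonNbrs-Unique S)

    commonNbrs-adj : ∀ S {w} → w ∈ commonNbrs S → All (Adj G w) S
    commonNbrs-adj []      _  = All.[]
    commonNbrs-adj (u ∷ S) w∈ with ∈-filter⁻ (λ w → adj? G w u) {xs = commonNbrs S} w∈
    ... | w∈′ , w~u = w~u All.∷ commonNbrs-adj S w∈′

    degree-outside : ∀ {d} S → Unique S → ∀ w → d ≤ degree G w →
                     d ∸ length S ≤ length (filter (adj? G w) (outside S))
    degree-outside {d} S S! w d≤deg = m≤n+o⇒m∸n≤o d (length S) (begin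
      d                                                   ≤⟨ d≤deg ⟩
      length (filter (adj? G w) (allFin n))               ≤⟨ length-filter-≤-split (adj? G w) (_∈? S) (allFin n) ⟩
      length (filter (_∈? S) (allFin n)) + deg-outside    ≡⟨ cong (_+ deg-outside) (length-filter-∈ S S!) ⟩
      length S + deg-outside                              ∎)
      where
        open ≤-Reasoning
        deg-outside = length (filter (adj? G w) (outside S))

    commonNbrs-extend : ∀ {d} → MinDegreeAtLeast G d → ∀ S → Unique S → length S < n →
      ∃ λ u → u ∉ S × length (commonNbrs S) * (d ∸ length S) ≤ length (commonNbrs (u ∷ S)) * (n ∸ length S)
    commonNbrs-extend {d} δ S S! s<n =
      let (u , u∈L , ∑≤) = ∃-∑≤length* L c′ L-nonempty in
      u , outside-∉ S u∈L , (begin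
        length C * (d ∸ s)                       ≡⟨ ∑-const C (d ∸ s) ⟨
        ∑[ w ← C ] (d ∸ s)                       ≤⟨ ∑-mono-≤ C (λ w → degree-outside S S! w (δ w)) ⟩
        ∑[ w ← C ] length (filter (adj? G w) L)  ≡⟨ double-count (adj? G) C L ⟩
        ∑ L c′                                   ≤⟨ ∑≤ ⟩
        length L * c′ u                          ≡⟨ cong (_* c′ u) (length-outside S S!) ⟩
        (n ∸ s) * c′ u                           ≡⟨ *-comm (n ∸ s) (c′ u) ⟩
        c′ u * (n ∸ s)                           ∎)
      where
        open ≤-Reasoning
        s = length S
        C = commonNbrs S
        L = outside S
        c′ : Fin n → ℕ
        c′ v = length (commonNbrs (v ∷ S))
        L-nonempty : 0 < length L
        L-nonempty = subst (0 <_) (≡-sym (length-outside S S!)) (m<n⇒0<n∸m s<n)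

    greedy : ∀ {d} → MinDegreeAtLeast G d → ∀ s → s ≤ n →
             ∃ λ S → Unique S × length S ≡ s × n * (d P′ s) ≤ length (commonNbrs S) * (n P′ s)
    greedy δ zero _ = [] , [] , refl , ≤-reflexive (cong (_* 1) (≡-sym (length-tabulate {n = n} (λ i → i))))
    greedy {d} δ (suc s) s<n with greedy δ s (<⇒≤ s<n)
    ... | S , S! , refl , bound with commonNbrs-extend δ S S! s<n
    ... | u , u∉S , extension = u ∷ S , ¬Any⇒All¬ S u∉S ∷ S! , refl , (begin
      n * ((d ∸ s) * (d P′ s))    ≡⟨ x∙yz≈y∙xz n (d ∸ s) (d P′ s) ⟩
      (d ∸ s) * (n * (d P′ s))    ≤⟨ *-monoʳ-≤ (d ∸ s) bound ⟩
      (d ∸ s) * (c * (n P′ s))    ≡⟨ x∙yz≈y∙xz (d ∸ s) c (n P′ s) ⟩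
      c * ((d ∸ s) * (n P′ s))    ≡⟨ *-assoc c (d ∸ s) (n P′ s) ⟨
      c * (d ∸ s) * (n P′ s)      ≤⟨ *-monoˡ-≤ (n P′ s) extension ⟩
      c′ * (n ∸ s) * (n P′ s)     ≡⟨ *-assoc c′ (n ∸ s) (n P′ s) ⟩
      c′ * ((n ∸ s) * (n P′ s))   ∎)
      where
        open ≤-Reasoning
        c = length (commonNbrs S)
        c′ = length (commonNbrs (u ∷ S))

    commonNbrs⇒ContainsKab : ∀ {r} S → Unique S → r ≤ length (commonNbrs S) →
                             ContainsKab G r (length S)
    commonNbrs⇒ContainsKab {r} S S! r≤c =
      f , lookup S , f-injective , lookup-injective S! _ _ , f≢g , f~g
      where
        f : Fin r → Fin n
        f i = lookup (commonNbrs S) (F.inject≤ i r≤c)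
        f-injective : ∀ {i j} → f i ≡ f j → i ≡ j
        f-injective {i} {j} eq =
          inject≤-injective r≤c r≤c i j (lookup-injective (commonNbrs-Unique S) _ _ eq)
        f~g : ∀ i j → Adj G (f i) (lookup S j)
        f~g i j = All.lookup (commonNbrs-adj S (∈-lookup (F.inject≤ i r≤c))) (∈-lookup j)
        f≢g : ∀ i j → ¬ f i ≡ lookup S j
        f≢g i j fi≡gj = irrefl G (subst (Adj G (f i)) (≡-sym fi≡gj) (f~g i j))

greedy-bound⇒2<c : ∀ {n c} d → 12 ≤ n → n ≤ suc (2 * d) → n * (d P′ 2) ≤ c * (n P′ 2) → 2 < c
greedy-bound⇒2<c {n} {c} d 12≤n n≤1+2d bound = *-cancelʳ-< (4 * (n ∸ 1)) 2 c (begin-strict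
  2 * (4 * (n ∸ 1))     ≡⟨ *-assoc 2 4 (n ∸ 1) ⟨
  8 * (n ∸ 1)           <⟨ *-monoˡ-< (n ∸ 1) {{>-nonZero 0<n∸1}} (n<1+n 8) ⟩
  9 * (n ∸ 1)           ≤⟨ *-monoˡ-≤ (n ∸ 1) (∸-monoˡ-≤ 3 12≤n) ⟩
  (n ∸ 3) * (n ∸ 1)     ≤⟨ *-mono-≤ n∸3≤2[d∸1] (∸-monoˡ-≤ 1 n≤1+2d) ⟩
  2 * (d ∸ 1) * (2 * d) ≡⟨ *-interchange 2 (d ∸ 1) 2 d ⟩
  4 * ((d ∸ 1) * d)     ≤⟨ *-monoʳ-≤ 4 cancelled ⟩
  4 * (c * (n ∸ 1))     ≡⟨ x∙yz≈y∙xz 4 c (n ∸ 1) ⟩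
  c * (4 * (n ∸ 1))     ∎)
  where
    open ≤-Reasoning
    0<n∸1 : 0 < n ∸ 1
    0<n∸1 = ≤-trans (s≤s z≤n) (∸-monoˡ-≤ 1 12≤n)
    n∸3≤2[d∸1] : n ∸ 3 ≤ 2 * (d ∸ 1)
    n∸3≤2[d∸1] = ≤-trans (∸-monoˡ-≤ 3 n≤1+2d) (≤-reflexive (≡-sym (*-distribˡ-∸ 2 d 1)))
    expand : ∀ n d e → n * (e * (d * 1)) ≡ (e * d) * n
    expand = solve-∀
    cancelled : (d ∸ 1) * d ≤ c * (n ∸ 1)
    cancelled = *-cancelʳ-≤ ((d ∸ 1) * d) (c * (n ∸ 1)) n {{>-nonZero (≤-trans (s≤s z≤n) 12≤n)}} (begin
      (d ∸ 1) * d * n          ≡⟨ expand n d (d ∸ 1) ⟨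
      n * (d P′ 2)             ≤⟨ bound ⟩
      c * (n P′ 2)             ≡⟨ *-assoc c (n ∸ 1) (n * 1) ⟨
      c * (n ∸ 1) * (n * 1)    ≡⟨ cong (c * (n ∸ 1) *_) (*-identityʳ n) ⟩
      c * (n ∸ 1) * n          ∎)

greedy-bound⇒3<c : ∀ {n c} d → 28 ≤ n → suc n ≤ 2 * d → n * (d P′ 3) ≤ c * (n P′ 3) → 3 < c
greedy-bound⇒3<c {n} {c} d 28≤n 1+n≤2d bound = *-cancelʳ-< (8 * (n ∸ 2)) 3 c (begin-strict
  3 * (8 * (n ∸ 2))     ≡⟨ *-assoc 3 8 (n ∸ 2) ⟨
  24 * (n ∸ 2)          ≤⟨ *-monoʳ-≤ 24 (m∸n≤m n 2) ⟩
  24 * n                <⟨ *-monoˡ-< n {{>-nonZero (≤-trans (s≤s z≤n) 28≤n)}} (n<1+n 24) ⟩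
  25 * n                ≤⟨ *-monoˡ-≤ n (∸-monoˡ-≤ 3 28≤n) ⟩
  (n ∸ 3) * n           ≤⟨ *-monoˡ-≤ n n∸3≤2[d∸2] ⟩
  2 * (d ∸ 2) * n       ≡⟨ xy∙z≈x∙zy 2 (d ∸ 2) n ⟩
  2 * (n * (d ∸ 2))     ≤⟨ *-monoʳ-≤ 2 cancelled ⟩
  2 * (c * (n ∸ 2) * 4) ≡⟨ regroup c (n ∸ 2) ⟩
  c * (8 * (n ∸ 2))     ∎)
  where
    open ≤-Reasoning
    n∸3≤2[d∸2] : n ∸ 3 ≤ 2 * (d ∸ 2)
    n∸3≤2[d∸2] = ≤-trans (∸-monoˡ-≤ 4 1+n≤2d) (≤-reflexive (≡-sym (*-distribˡ-∸ 2 d 2)))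
    2≤d : 2 ≤ d
    2≤d = *-cancelˡ-≤ 2 (≤-trans (s≤s (≤-trans (s≤s (s≤s (s≤s z≤n))) 28≤n)) 1+n≤2d)
    regroup : ∀ x y → 2 * (x * y * 4) ≡ x * (8 * y)
    regroup = solve-∀
    X = d P′ 2
    cancelled : n * (d ∸ 2) ≤ c * (n ∸ 2) * 4
    cancelled = *-cancelʳ-≤ (n * (d ∸ 2)) (c * (n ∸ 2) * 4) X {{>-nonZero (P′-positive 2 2≤d)}} (begin
      n * (d ∸ 2) * X          ≡⟨ *-assoc n (d ∸ 2) X ⟩
      n * (d P′ 3)             ≤⟨ bound ⟩
      c * (n P′ 3)             ≡⟨ *-assoc c (n ∸ 2) (n P′ 2) ⟨
      c * (n ∸ 2) * (n P′ 2)   ≤⟨ *-monoʳ-≤ (c * (n ∸ 2)) (P′≤2^*P′ n d 2 (s≤s 1+n≤2d)) ⟩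
      c * (n ∸ 2) * (4 * X)    ≡⟨ *-assoc (c * (n ∸ 2)) 4 X ⟨
      c * (n ∸ 2) * 4 * X      ∎)

greedy-bound⇒n≤2^k*c : ∀ {n c} d k → k + n ≤ suc (2 * d) → k ≤ d →
                       n * (d P′ k) ≤ c * (n P′ k) → n ≤ 2 ^ k * c
greedy-bound⇒n≤2^k*c {n} {c} d k k+n≤1+2d k≤d bound =
  *-cancelʳ-≤ n (2 ^ k * c) (d P′ k) {{>-nonZero (P′-positive k k≤d)}} (begin
  n * (d P′ k)             ≤⟨ bound ⟩
  c * (n P′ k)             ≤⟨ *-monoʳ-≤ c (P′≤2^*P′ n d k k+n≤1+2d) ⟩
  c * (2 ^ k * (d P′ k))   ≡⟨ x∙yz≈yx∙z c (2 ^ k) (d P′ k) ⟩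
  2 ^ k * c * (d P′ k)     ∎)
  where open ≤-Reasoning

n≤2^k*c⇒k<c : ∀ {n c} k → k * 2 ^ k < n → n ≤ 2 ^ k * c → k < c
n≤2^k*c⇒k<c {n} {c} k k2^k<n n≤2^kc = *-cancelˡ-< (2 ^ k) k c (begin-strict
  2 ^ k * k   ≡⟨ *-comm (2 ^ k) k ⟩
  k * 2 ^ k   <⟨ k2^k<n ⟩
  n           ≤⟨ n≤2^kc ⟩
  2 ^ k * c   ∎)
  where open ≤-Reasoning

n≤1+2[n/2] : ∀ n → n ≤ suc (2 * (n / 2))
n≤1+2[n/2] n = begin
  n                     ≡⟨ m≡m%n+[m/n]*n n 2 ⟩
  n % 2 + n / 2 * 2     ≤⟨ +-mono-≤ (≤-pred (m%n<n n 2)) (≤-reflexive (*-comm (n / 2) 2)) ⟩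
  suc (2 * (n / 2))     ∎
  where open ≤-Reasoning

greedy-bound⇒r≤c : ∀ r {n c} → 3 ≤ r → (r ∸ 1) * 2 ^ (r ∸ 1) + 4 ≤ n →
                   n * ((n / 2 + (r ∸ 3)) P′ (r ∸ 1)) ≤ c * (n P′ (r ∸ 1)) → r ≤ c
greedy-bound⇒r≤c 0 () _ _
greedy-bound⇒r≤c 1 (s≤s ()) _ _
greedy-bound⇒r≤c 2 (s≤s (s≤s ())) _ _
greedy-bound⇒r≤c 3 {n} _ 12≤n bound = greedy-bound⇒2<c (n / 2 + 0) 12≤n n≤1+2d bound
  where
    n≤1+2d : n ≤ suc (2 * (n / 2 + 0))
    n≤1+2d = subst (λ h → n ≤ suc (2 * h)) (≡-sym (+-identityʳ (n / 2))) (n≤1+2[n/2] n)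
greedy-bound⇒r≤c 4 {n} _ 28≤n bound = greedy-bound⇒3<c (n / 2 + 1) 28≤n 1+n≤2d bound
  where
    2+2h≡2[h+1] : ∀ h → suc (suc (2 * h)) ≡ 2 * (h + 1)
    2+2h≡2[h+1] = solve-∀
    1+n≤2d : suc n ≤ 2 * (n / 2 + 1)
    1+n≤2d = ≤-trans (s≤s (n≤1+2[n/2] n)) (≤-reflexive (2+2h≡2[h+1] (n / 2)))
greedy-bound⇒r≤c r@(suc (suc (suc (suc (suc _))))) {n} _ large bound =
  n≤2^k*c⇒k<c k k2^k<n (greedy-bound⇒n≤2^k*c (h + t) k k+n≤1+2d k≤d bound)
  where
    k = r ∸ 1
    t = r ∸ 3
    h = n / 2
    k2^k<n : k * 2 ^ k < n
    k2^k<n = <-≤-trans (m<m+n _ (s≤s z≤n)) large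
    2≤h : 2 ≤ h
    2≤h = /-mono-≤ {o = 2} {p = 2} (≤-trans (m≤n+m 4 (k * 2 ^ k)) large) ≤-refl
    k≤d : k ≤ h + t
    k≤d = +-monoˡ-≤ t 2≤h
    k≤2t : k ≤ 2 * t
    k≤2t = ≤-trans (+-monoˡ-≤ t (s≤s (s≤s z≤n))) (≤-reflexive (cong (t +_) (≡-sym (+-identityʳ t))))
    regroup : ∀ t h → 2 * t + suc (2 * h) ≡ suc (2 * (h + t))
    regroup = solve-∀
    k+n≤1+2d : k + n ≤ suc (2 * (h + t))
    k+n≤1+2d = ≤-trans (+-mono-≤ k≤2t (n≤1+2[n/2] n)) (≤-reflexive (regroup t h))

lemma3p4 : (r n : ℕ) → 3 ≤ r → (r ∸ 1) * 2 ^ (r ∸ 1) + 4 ≤ n →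
    (G : Graph n) → MinDegreeAtLeast G (n / 2 + (r ∸ 3)) →
    ContainsKab G r (r ∸ 1)
lemma3p4 r n 3≤r large G δ =
  let (S , S! , |S|≡r-1 , bound) = greedy G δ (r ∸ 1) r-1≤n
  in subst (ContainsKab G r) |S|≡r-1 (commonNbrs⇒ContainsKab G S S! (greedy-bound⇒r≤c r 3≤r large bound))
  where
    r-1≤n : r ∸ 1 ≤ n
    r-1≤n = ≤-trans (m≤m*n (r ∸ 1) (2 ^ (r ∸ 1)) {{m^n≢0 2 (r ∸ 1)}}) (≤-trans (m≤m+n _ 4) large)
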